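{- Let $G$ be a graph, let $t \ge 2$ and $k \ge 0$ be integers, and let $\mathcal{F}$ be a family of sets of the form $E_Z$ with $Z \subseteq V(G)$. Let $(x,y)$ be an edge of $G$, and let $\mathcal{F}_{xy} = \{X \subseteq V(G)\setminus\{x,y\} : E_{X\cup\{x,y\}} \in \mathcal{F}\}$. Suppose $|\mathcal{F}_{xy}| > 2\cdot (t-2)!\cdot k^{t-2}$ and that $X_1,\ldots,X_{k+1} \in \mathcal{F}_{xy}$ form a sunflower with core $Y$. Let $\mathcal{F}'$ be obtained from $\mathcal{F}$ by removing every set $E_Z \in \mathcal{F}$ with $Y \cup \{x,y\} \subseteq Z$ and then adding the set $E_{Y\cup\{x,y\}}$. Then for every set $S$ of edges of $G$ with $|S| \le k$, $S$ is a hitting set of $\mathcal{F}$ if and only if $S$ is a hitting set of $\mathcal{F}'$.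
   Context: For a set of vertices $X$, $E_X$ denotes the set of all pairs $(x,y)$ (unordered, i.e. potential edges) with $x,y \in X$, $x \neq y$. A set $S$ is a hitting set of a family $\mathcal{F}$ if $S \cap F \neq \emptyset$ for every $F \in \mathcal{F}$. Distinct sets $S_1,\ldots,S_p$ of a family form a sunflower with core $Y$ if $S_i \cap S_j = Y$ for all $i \neq j$ and $S_i \setminus Y \neq \emptyset$ for every $i$. (In the paper's setting, $\mathcal{F}$ initially consists of the sets $E_X$ for all cliques $X$ of size $t$ in $G$, and is then modified by repeated applications of the described operation.) -}

module Defs where

open import Data.Nat using (ℕ; suc)
import Data.Bool.Properties as BoolP
open import Data.Fin using (Fin)
open import Data.Fin.Subset using (Subset; _∈_; _∉_; _∪_; _∩_; _─_; _⊆_; ⁅_⁆)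
open import Data.Fin.Subset.Properties using (_∈?_; _⊆?_)
open import Data.Vec.Properties using (≡-dec)
open import Data.List using (List; []; _∷_; filter; map; _++_; deduplicate)
import Data.List.Membership.Propositional as LM
open import Data.List.Relation.Unary.All using (All)
open import Data.List.Relation.Unary.Any using (Any)
open import Data.Product using (Σ; _×_; _,_; ∃)
open import Relation.Binary.Definitions using (DecidableEquality)
open import Relation.Binary.PropositionalEquality using (_≡_; _≢_)
open import Relation.Nullary using (¬_; ¬?)
open import Relation.Nullary.Decidable using (_×-dec_)

record Graph (n : ℕ) : Set₁ where
  field
    Adj     : Fin n → Fin n → Set
    sym     : ∀ {u v} → Adj u v → Adj v u
    irrefl  : ∀ {u} → ¬ Adj u u

_≟ₛ_ : ∀ {n} → DecidableEquality (Subset n)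
_≟ₛ_ = ≡-dec BoolP._≟_

-- A family F of sets of the form E_Z is represented by the list of the
-- vertex sets Z; i.e. the family is { E_Z : Z ∈ F }.
Family : ℕ → Set
Family n = List (Subset n)

EdgeSet : ℕ → Set
EdgeSet n = List (Fin n × Fin n)

-- S ∩ E_Z ≠ ∅ : some pair of S has both endpoints in Z.
Hits : ∀ {n} → EdgeSet n → Subset n → Set
Hits S Z = Any (λ e → (Data.Product.proj₁ e ∈ Z) × (Data.Product.proj₂ e ∈ Z)) S

HittingSet : ∀ {n} → EdgeSet n → Family n → Set
HittingSet S F = All (Hits S) F

pair : ∀ {n} → Fin n → Fin n → Subset n
pair x y = ⁅ x ⁆ ∪ ⁅ y ⁆

InFxy : ∀ {n} → Family n → Fin n → Fin n → Subset n → Set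
InFxy F x y X = (x ∉ X) × (y ∉ X) × ((X ∪ pair x y) LM.∈ F)

-- F_xy as a duplicate-free list (its length is |F_xy|).
Fxy : ∀ {n} → Family n → Fin n → Fin n → List (Subset n)
Fxy F x y =
  deduplicate _≟ₛ_ (map (λ Z → Z ─ pair x y) (filter (λ Z → (x ∈? Z) ×-dec (y ∈? Z)) F))

Sunflower : ∀ {n m} → (Fin m → Subset n) → Subset n → Set
Sunflower X Y =
  (∀ i j → i ≢ j → X i ≢ X j) ×
  (∀ i j → i ≢ j → (X i ∩ X j) ≡ Y) ×
  (∀ i → ∃ λ v → (v ∈ X i) × (v ∉ Y))

reduce : ∀ {n} → Family n → Fin n → Fin n → Subset n → Family n
reduce F x y Y =
  filter (λ Z → ¬? ((Y ∪ pair x y) ⊆? Z)) F ++ ((Y ∪ pair x y) ∷ [])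

module Submission where

-- Write W = Y ∪ {x,y}.  The reduced family F' is F with
-- every superset of W removed and W itself added, so a set S of edges hits F'
-- iff it hits the pruned family and hits W.  Hitting W already forces hitting
-- every superset of W, hence "S hits F'" implies "S hits F".  Conversely, if S
-- hits F it hits each of the k + 1 petal sets E_{X i ∪ {x,y}} ∈ F; since S has
-- at most k edges, by pigeonhole a single edge hits two petals X i, X j, i ≠ j,
-- and then both its endpoints lie in (X i ∪ {x,y}) ∩ (X j ∪ {x,y}) = W.
-- (The size bound on F_xy, the value of t and the adjacency hypotheses are not
-- needed for this equivalence; they only matter elsewhere in the paper.)

open import Defs
open import Data.Nat using (ℕ; suc; _*_; _^_; _∸_; _≤_; _<_; _!)
open import Data.Fin using (Fin)
open import Data.Fin.Subset using (Subset)
open import Data.List using (List; length)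
open import Data.List.Relation.Unary.All using (All)
open import Data.Product using (_×_; _,_; proj₁; proj₂)
open import Function.Bundles using (_⇔_)

open import Data.Nat using (s≤s)
open import Data.Fin.Properties using (suc-injective; pigeonhole; <⇒≢)
open import Data.Fin.Subset using (_∈_; _∪_; _∩_; _⊆_)
open import Data.Fin.Subset.Properties using (x∈p∩q⁺; ∪-distribʳ-∩; _⊆?_)
open import Data.List using ([]; _∷_; filter)
open import Data.List.Relation.Unary.Any as Any using (Any; here; there; index)
open import Data.List.Relation.Unary.All as All using ([]; _∷_)
open import Data.List.Relation.Unary.All.Properties
  using (++⁺; ++⁻; filter⁺; filter⁻; all-filter)
open import Relation.Binary.PropositionalEquality using (_≡_; _≢_; subst; sym)
open import Relation.Nullary using (¬?)
open import Function.Bundles using (mk⇔)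

-- This turns a pigeonhole collision of positions into one edge.
any-at-same-index : ∀ {A : Set} {P Q : A → Set} {xs : List A}
  (p : Any P xs) (q : Any Q xs) → index p ≡ index q →
  Any (λ e → P e × Q e) xs
any-at-same-index (here px) (here qx) _  = here (px , qx)
any-at-same-index (there p) (there q) eq = there (any-at-same-index p q (suc-injective eq))
any-at-same-index (here _)  (there _) ()
any-at-same-index (there _) (here _)  ()

module _ {n : ℕ} where

  -- Two petals X, X' with X ∩ X' = Y, both enlarged by the same set P, meet
  -- exactly in Y ∪ P, since (X ∩ X') ∪ P = (X ∪ P) ∩ (X' ∪ P).
  ∈-petals⇒∈-core : ∀ {X X' Y P : Subset n} {w} → X ∩ X' ≡ Y →
    w ∈ X ∪ P → w ∈ X' ∪ P → w ∈ Y ∪ P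
  ∈-petals⇒∈-core {X} {X'} {P = P} core w∈X∪P w∈X'∪P =
    subst (λ Z → _ ∈ Z ∪ P) core
      (subst (_ ∈_) (sym (∪-distribʳ-∩ P X X')) (x∈p∩q⁺ (w∈X∪P , w∈X'∪P)))

  hits-⊆ : ∀ {S : EdgeSet n} {W Z : Subset n} → W ⊆ Z → Hits S W → Hits S Z
  hits-⊆ W⊆Z = Any.map (λ (u∈W , v∈W) → W⊆Z u∈W , W⊆Z v∈W)

  pruneSupersets : Subset n → Family n → Family n
  pruneSupersets W = filter (λ Z → ¬? (W ⊆? Z))

  hittingSet-unprune : ∀ {S : EdgeSet n} {W : Subset n} (F : Family n) →
    Hits S W → HittingSet S (pruneSupersets W F) → HittingSet S F
  hittingSet-unprune {W = W} F hitW hitPruned =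
    filter⁻ (W ⊆?_)
      (All.map {P = W ⊆_} (λ W⊆Z → hits-⊆ W⊆Z hitW) (all-filter (W ⊆?_) F))
      hitPruned

  -- Sunflower argument: if S hits every E_{X i ∪ P} for m > |S| petals whose
  -- pairwise intersections are Y, then two petals are hit by the same edge,
  -- and that edge lies in E_{Y ∪ P}.
  petals-force-core : ∀ {m} (S : EdgeSet n) (X : Fin m → Subset n) (Y P : Subset n) →
    (∀ i j → i ≢ j → X i ∩ X j ≡ Y) → length S < m →
    (∀ i → Hits S (X i ∪ P)) → Hits S (Y ∪ P)
  petals-force-core S X Y P core |S|<m hitPetal
    with pigeonhole |S|<m (λ i → index (hitPetal i))
  ... | i , j , i<j , sameEdge =
    Any.map (λ ((u∈i , v∈i) , (u∈j , v∈j)) →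
               ∈-petals⇒∈-core coreᵢⱼ u∈i u∈j , ∈-petals⇒∈-core coreᵢⱼ v∈i v∈j)
            (any-at-same-index (hitPetal i) (hitPetal j) sameEdge)
    where coreᵢⱼ = core i j (<⇒≢ i<j)

lemma2 : ∀ {n} (G : Graph n) (t k : ℕ) → 2 ≤ t →
    (F : Family n) (x y : Fin n) → Graph.Adj G x y →
    2 * (t ∸ 2) ! * k ^ (t ∸ 2) < length (Fxy F x y) →
    (X : Fin (suc k) → Subset n) (Y : Subset n) →
    (∀ i → InFxy F x y (X i)) → Sunflower X Y →
    (S : EdgeSet n) → All (λ e → Graph.Adj G (proj₁ e) (proj₂ e)) S →
    length S ≤ k →
    (HittingSet S F ⇔ HittingSet S (reduce F x y Y))
lemma2 G t k _ F x y _ _ X Y inFxy (_ , core , _) S _ |S|≤k = mk⇔ to from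
  where
  -- Each petal gives a member X i ∪ {x,y} of F.
  hitsCore : HittingSet S F → Hits S (Y ∪ pair x y)
  hitsCore hitF = petals-force-core S X Y (pair x y) core (s≤s |S|≤k)
    (λ i → All.lookup hitF (proj₂ (proj₂ (inFxy i))))

  to : HittingSet S F → HittingSet S (reduce F x y Y)
  to hitF = ++⁺ (filter⁺ _ hitF) (hitsCore hitF ∷ [])

  from : HittingSet S (reduce F x y Y) → HittingSet S F
  from hitF' with hitPruned , hitCore ∷ [] ← ++⁻ (pruneSupersets (Y ∪ pair x y) F) hitF'
    = hittingSet-unprune F hitCore hitPruned
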